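{- Let $\Delta$ be a shellable $d$-dimensional simplicial complex with at most $d+2$ vertices. Then $\Delta$ is vertex decomposable.
   Context: A pure $d$-dimensional complex is shellable if its facets can be ordered $F_1,\dots,F_s$ so that for each $k\ge 2$ the complex generated by the sets $F_i\cap F_k$, $i<k$, is pure of dimension $d-1$. Vertices are $v$ with $\{v\}\in\Delta$. A simplex is a complex $2^W$ (including $\emptyset,\{\emptyset\}$). $\mathrm{lk}_\Delta(v)=\{G\in\Delta: v\notin G,\ G\cup\{v\}\in\Delta\}$, $\mathrm{del}_\Delta(v)=\{G\in\Delta: v\notin G\}$. $\Delta$ is vertex decomposable if it is a simplex, or it has a vertex $v$ with $\mathrm{del}_\Delta(v)$, $\mathrm{lk}_\Delta(v)$ vertex decomposable and every facet of $\mathrm{del}_\Delta(v)$ a facet of $\Delta$. -}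

module Defs where

open import Data.Nat using (ℕ; suc; _+_; _≤_)
open import Data.Fin using (Fin; _<_)
open import Data.Fin.Subset using (Subset; ⁅_⁆; _∈_; _∉_; _⊆_; _∩_; _∪_; ∣_∣)
open import Data.Product using (Σ; ∃; ∃-syntax; _×_; _,_)
open import Data.Sum using (_⊎_)
open import Data.Empty using (⊥)
open import Relation.Nullary using (¬_)
open import Relation.Binary.PropositionalEquality using (_≡_)
open import Function using (_⇔_)
open import Function.Definitions using (Injective)

-- A (candidate) family of faces on the ground set Fin n: a predicate on subsets.
Cx : ℕ → Set₁
Cx n = Subset n → Set

module _ {n : ℕ} where

  IsFacet : Cx n → Subset n → Set
  IsFacet Δ F = Δ F × (∀ G → Δ G → F ⊆ G → G ≡ F)

  -- simplex 2^W, including the void complex ∅ (and {∅} = 2^∅)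
  IsSimplex : Cx n → Set
  IsSimplex Δ = (∀ G → ¬ Δ G) ⊎ (∃[ W ] (∀ G → Δ G ⇔ G ⊆ W))

  del : Cx n → Fin n → Cx n
  del Δ v G = v ∉ G × Δ G

  lk : Cx n → Fin n → Cx n
  lk Δ v G = v ∉ G × Δ (G ∪ ⁅ v ⁆)

  data VertexDecomposable : Cx n → Set₁ where
    simplex : ∀ {Δ} → IsSimplex Δ → VertexDecomposable Δ
    shedding : ∀ {Δ} (v : Fin n) → Δ ⁅ v ⁆ →
      VertexDecomposable (del Δ v) →
      VertexDecomposable (lk Δ v) →
      (∀ F → IsFacet (del Δ v) F → IsFacet Δ F) →
      VertexDecomposable Δ

  -- Δ is a pure complex of dimension d = r - 1 (facets have r elements) that is
  -- shellable: Δ is generated by distinct facets F₀,…,F_s (at least one), all of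
  -- size r, ordered so that for each k and each i < k, F i ∩ F k lies in some
  -- F j ∩ F k (j < k) of size r - 1 (= dimension d - 1), i.e. the complex
  -- generated by {F i ∩ F k : i < k} is pure of dimension d - 1.
  PureShellable : ℕ → Cx n → Set
  PureShellable r Δ =
    ∃[ s ] Σ (Fin (suc s) → Subset n) λ F →
      Injective _≡_ _≡_ F ×
      (∀ i → ∣ F i ∣ ≡ r) ×
      (∀ G → Δ G ⇔ (∃[ i ] G ⊆ F i)) ×
      (∀ k i → i < k →
         ∃[ j ] (j < k × (F i ∩ F k) ⊆ (F j ∩ F k) × suc ∣ F j ∩ F k ∣ ≡ r))

  AtMostVertices : ℕ → Cx n → Set
  AtMostVertices m Δ = ∃[ V ] (∣ V ∣ ≤ m × (∀ v → Δ ⁅ v ⁆ → v ∈ V))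

-- If the vertex set V has at most r elements, the r-element facets all equal V and the complex is
-- a simplex.  Otherwise every facet is V - y for some y ∈ V, so the complex is generated by facets
-- of the boundary of 2^V.  Shedding the vertex x omitted by one of these facets works: its deletion
-- is the simplex 2^(V - x), whose only facet V - x is a facet of the whole complex, and its link is
-- generated by the boundary facets (V - x) - y of 2^(V - x) for the remaining omitted vertices y.
module Submission where

open import Defs
open import Data.Nat using (ℕ; suc; _≤_)
open import Data.Nat.Properties using (≤-pred; ≤-trans; ≤-reflexive; <⇒≱; m≤n⇒m<n∨m≡n)
open import Data.Fin using (Fin; zero)
open import Data.Fin.Properties using (_≟_; ¬∀⟶∃¬)
open import Data.Fin.Subset using (Subset; ⁅_⁆; _∈_; _∉_; _⊆_; _⊈_; _∪_; _─_; _-_; ∣_∣)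
open import Data.Fin.Subset.Properties
  using (_∈?_; _⊆?_; ⊆-refl; ⊆-trans; ⊆-antisym; x∈⁅x⁆; x∈⁅y⁆⇒x≡y; x≢y⇒x∉⁅y⁆; x∈p∪q⁺; x∈p∪q⁻;
         p─q⊆p; x∈p∧x≢y⇒x∈p-y; p⊆q⇒∣p∣≤∣q∣; p⊂q⇒∣p∣<∣q∣; x∈p⇒∣p-x∣<∣p∣)
open import Data.Vec.Base as Vec using (_∷_)
open import Data.List using (List; []; _∷_; [_]; tabulate)
open import Data.List.Relation.Unary.All as All using (All; []; _∷_)
import Data.List.Relation.Unary.All.Properties as Allₚ
open import Data.List.Relation.Unary.Any as Any using (Any; here; there; any?)
import Data.List.Relation.Unary.Any.Properties as Anyₚ
open import Data.Product using (∃-syntax; _×_; _,_; proj₁; proj₂; map₂; swap)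
open import Data.Sum using (inj₁; inj₂; [_,_]′)
open import Data.Empty using (⊥-elim)
open import Relation.Nullary using (¬_; yes; no)
open import Relation.Nullary.Decidable using (_→-dec_)
open import Relation.Binary.PropositionalEquality using (_≡_; _≢_; refl; sym; trans; cong; subst)
open import Function using (_⇔_; mk⇔; _∘_)
open import Function.Bundles using (module Equivalence)

open Equivalence using (to; from)

private variable
  k m : ℕ
  x : Fin m
  p q U V : Subset m
  ys : List (Fin m)
  Δ Γ : Cx m

All×Any⇒Any× : {A : Set} {P Q : A → Set} {as : List A} →
  All P as → Any Q as → Any (λ a → P a × Q a) as
All×Any⇒Any× (pa ∷ _)   (here qa)  = here (pa , qa)
All×Any⇒Any× (_  ∷ pas) (there qa) = there (All×Any⇒Any× pas qa)

x∈p─q⇒x∉q : ∀ (p q : Subset m) → x ∈ p ─ q → x ∉ q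
-- at position zero, x ∈ p ─ q and x ∈ q cannot both hold, so only the `there` case remains
x∈p─q⇒x∉q (_ ∷ p) (_ ∷ q) (Vec.there x∈p─q) (Vec.there x∈q) = x∈p─q⇒x∉q p q x∈p─q x∈q

x∉p-x : x ∉ p - x
x∉p-x {x = x} {p = p} x∈p-x = x∈p─q⇒x∉q p ⁅ x ⁆ x∈p-x (x∈⁅x⁆ x)

p⊆q-x⇒p⊆q : p ⊆ q - x → p ⊆ q
p⊆q-x⇒p⊆q {q = q} {x = x} p⊆q-x = ⊆-trans p⊆q-x (p─q⊆p q ⁅ x ⁆)

p⊆q-x⇒x∉p : p ⊆ q - x → x ∉ p
p⊆q-x⇒x∉p p⊆q-x x∈p = x∉p-x (p⊆q-x x∈p)

p⊆q∧x∉p⇒p⊆q-x : p ⊆ q → x ∉ p → p ⊆ q - x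
p⊆q∧x∉p⇒p⊆q-x p⊆q x∉p y∈p = x∈p∧x≢y⇒x∈p-y (p⊆q y∈p) λ { refl → x∉p y∈p }

⁅x⁆⊆p : x ∈ p → ⁅ x ⁆ ⊆ p
⁅x⁆⊆p {x = x} x∈p y∈⁅x⁆ = subst (_∈ _) (sym (x∈⁅y⁆⇒x≡y x y∈⁅x⁆)) x∈p

p⊆q∧x∈q⇒p∪⁅x⁆⊆q : p ⊆ q → x ∈ q → p ∪ ⁅ x ⁆ ⊆ q
p⊆q∧x∈q⇒p∪⁅x⁆⊆q {p = p} {x = x} p⊆q x∈q y∈p∪⁅x⁆ =
  [ p⊆q , ⁅x⁆⊆p x∈q ]′ (x∈p∪q⁻ p ⁅ x ⁆ y∈p∪⁅x⁆)

p⊈q⇒∃x∈p∉q : p ⊈ q → ∃[ x ] (x ∈ p × x ∉ q)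
p⊈q⇒∃x∈p∉q {p = p} {q = q} p⊈q
  with ¬∀⟶∃¬ _ (λ x → x ∈ p → x ∈ q) (λ x → x ∈? p →-dec x ∈? q) (λ p⊆q → p⊈q (p⊆q _))
... | x , x∈p↛x∈q with x ∈? p
...   | yes x∈p = x , x∈p , λ x∈q → x∈p↛x∈q (λ _ → x∈q)
...   | no  x∉p = ⊥-elim (x∈p↛x∈q (⊥-elim ∘ x∉p))

p⊆q∧∣q∣≤∣p∣⇒q⊆p : p ⊆ q → ∣ q ∣ ≤ ∣ p ∣ → q ⊆ p
p⊆q∧∣q∣≤∣p∣⇒q⊆p {p = p} {q = q} p⊆q ∣q∣≤∣p∣ with q ⊆? p
... | yes q⊆p = q⊆p
... | no  q⊈p = let x , x∈q , x∉p = p⊈q⇒∃x∈p∉q q⊈p in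
  ⊥-elim (<⇒≱ (p⊂q⇒∣p∣<∣q∣ (p⊆q , x , x∈q , x∉p)) ∣q∣≤∣p∣)

p⊆q∧∣q∣≡1+∣p∣⇒p≡q-x : p ⊆ q → ∣ q ∣ ≡ suc ∣ p ∣ → ∃[ x ] (x ∈ q × p ≡ q - x)
p⊆q∧∣q∣≡1+∣p∣⇒p≡q-x {p = p} {q = q} p⊆q ∣q∣≡1+∣p∣ =
  let x , x∈q , x∉p = p⊈q⇒∃x∈p∉q q⊈p
      ∣q-x∣≤∣p∣ = ≤-pred (≤-trans (x∈p⇒∣p-x∣<∣p∣ x∈q) (≤-reflexive ∣q∣≡1+∣p∣))
      p⊆q-x = p⊆q∧x∉p⇒p⊆q-x p⊆q x∉p
  in x , x∈q , ⊆-antisym p⊆q-x (p⊆q∧∣q∣≤∣p∣⇒q⊆p p⊆q-x ∣q-x∣≤∣p∣)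
  where
  q⊈p : q ⊈ p
  q⊈p q⊆p = <⇒≱ (≤-reflexive (sym ∣q∣≡1+∣p∣)) (p⊆q⇒∣p∣≤∣q∣ q⊆p)

infix 4 _≋_
_≋_ : Cx m → Cx m → Set
Δ ≋ Γ = (∀ {G} → Δ G → Γ G) × (∀ {G} → Γ G → Δ G)

≋⇒⇔ : Δ ≋ Γ → ∀ G → Δ G ⇔ Γ G
≋⇒⇔ (Δ⊆Γ , Γ⊆Δ) G = mk⇔ Δ⊆Γ Γ⊆Δ

⇔⇒≋ : (∀ G → Δ G ⇔ Γ G) → Δ ≋ Γ
⇔⇒≋ Δ⇔Γ = (λ {G} → to (Δ⇔Γ G)) , (λ {G} → from (Δ⇔Γ G))

≋-sym : Δ ≋ Γ → Γ ≋ Δ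
≋-sym = swap

≋-trans : {Θ : Cx m} → Δ ≋ Γ → Γ ≋ Θ → Δ ≋ Θ
≋-trans (Δ⊆Γ , Γ⊆Δ) (Γ⊆Θ , Θ⊆Γ) = Γ⊆Θ ∘ Δ⊆Γ , Γ⊆Δ ∘ Θ⊆Γ

del-resp-≋ : ∀ v → Δ ≋ Γ → del Δ v ≋ del Γ v
del-resp-≋ v (Δ⊆Γ , Γ⊆Δ) = map₂ Δ⊆Γ , map₂ Γ⊆Δ

lk-resp-≋ : ∀ v → Δ ≋ Γ → lk Δ v ≋ lk Γ v
lk-resp-≋ v (Δ⊆Γ , Γ⊆Δ) = map₂ Δ⊆Γ , map₂ Γ⊆Δ

IsSimplex-resp-≋ : Δ ≋ Γ → IsSimplex Δ → IsSimplex Γ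
IsSimplex-resp-≋ (_ , Γ⊆Δ) (inj₁ void) = inj₁ λ G ΓG → void G (Γ⊆Δ ΓG)
IsSimplex-resp-≋ Δ≋Γ (inj₂ (W , Δ⇔2^W)) = inj₂ (W , ≋⇒⇔ (≋-trans (≋-sym Δ≋Γ) (⇔⇒≋ Δ⇔2^W)))

IsFacet-resp-≋ : Δ ≋ Γ → IsFacet Δ p → IsFacet Γ p
IsFacet-resp-≋ (Δ⊆Γ , Γ⊆Δ) (ΔF , maximal) = Δ⊆Γ ΔF , λ G ΓG F⊆G → maximal G (Γ⊆Δ ΓG) F⊆G

VertexDecomposable-resp-≋ : Δ ≋ Γ → VertexDecomposable Δ → VertexDecomposable Γ
VertexDecomposable-resp-≋ Δ≋Γ (simplex s) = simplex (IsSimplex-resp-≋ Δ≋Γ s)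
VertexDecomposable-resp-≋ Δ≋Γ (shedding v Δv delVD lkVD facets) =
  shedding v (proj₁ Δ≋Γ Δv)
    (VertexDecomposable-resp-≋ (del-resp-≋ v Δ≋Γ) delVD)
    (VertexDecomposable-resp-≋ (lk-resp-≋ v Δ≋Γ) lkVD)
    (λ F → IsFacet-resp-≋ Δ≋Γ ∘ facets F ∘ IsFacet-resp-≋ (del-resp-≋ v (≋-sym Δ≋Γ)))

simplex-vertexDecomposable : Δ ≋ (_⊆ U) → VertexDecomposable Δ
simplex-vertexDecomposable {U = U} Δ≋2^U = simplex (inj₂ (U , ≋⇒⇔ Δ≋2^U))

facet-of-simplex : Δ ≋ (_⊆ U) → IsFacet Δ p → p ≡ U
facet-of-simplex (Δ⊆2^U , 2^U⊆Δ) (ΔF , maximal) = sym (maximal _ (2^U⊆Δ ⊆-refl) (Δ⊆2^U ΔF))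

-- The subcomplex of the boundary of 2^U generated by the facets U - y, y ∈ ys (with ys ⊆ U).
Avoiding : Subset m → List (Fin m) → Cx m
Avoiding U ys G = G ⊆ U × Any (_∉ G) ys

Avoiding-void : ∀ G → ¬ Avoiding U [] G
Avoiding-void G (_ , ())

Avoiding-single : Avoiding U [ x ] ≋ (_⊆ U - x)
Avoiding-single =
  (λ { (G⊆U , here x∉G) → p⊆q∧x∉p⇒p⊆q-x G⊆U x∉G }) ,
  (λ G⊆U-x → p⊆q-x⇒p⊆q G⊆U-x , here (p⊆q-x⇒x∉p G⊆U-x))

Avoiding-dedup : Any (x ≡_) ys → Avoiding U (x ∷ ys) ≋ Avoiding U ys
Avoiding-dedup x∈ys =
  (λ { (G⊆U , here x∉G)  → G⊆U , Any.map (λ { refl → x∉G }) x∈ys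
     ; (G⊆U , there y∉G) → G⊆U , y∉G }) ,
  (λ (G⊆U , y∉G) → G⊆U , there y∉G)

Avoiding-vertex : {y : Fin m} → x ∈ U → x ≢ y → Avoiding U (x ∷ y ∷ ys) ⁅ x ⁆
Avoiding-vertex x∈U x≢y = ⁅x⁆⊆p x∈U , there (here (x≢y⇒x∉⁅y⁆ (x≢y ∘ sym)))

del-Avoiding : del (Avoiding U (x ∷ ys)) x ≋ (_⊆ U - x)
del-Avoiding =
  (λ (x∉G , G⊆U , _) → p⊆q∧x∉p⇒p⊆q-x G⊆U x∉G) ,
  (λ G⊆U-x → let x∉G = p⊆q-x⇒x∉p G⊆U-x in x∉G , p⊆q-x⇒p⊆q G⊆U-x , here x∉G)

lk-Avoiding : x ∈ U → All (x ≢_) ys → lk (Avoiding U (x ∷ ys)) x ≋ Avoiding (U - x) ys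
lk-Avoiding {x = x} {U = U} {ys = ys} x∈U x∉ys = lk⇒ , lk⇐
  where
  G⊆G∪⁅x⁆ : ∀ {G} → G ⊆ G ∪ ⁅ x ⁆
  G⊆G∪⁅x⁆ = x∈p∪q⁺ ∘ inj₁

  lk⇒ : ∀ {G} → lk (Avoiding U (x ∷ ys)) x G → Avoiding (U - x) ys G
  lk⇒ (_   , _       , here x∉G∪⁅x⁆) = ⊥-elim (x∉G∪⁅x⁆ (x∈p∪q⁺ (inj₂ (x∈⁅x⁆ x))))
  lk⇒ (x∉G , G∪⁅x⁆⊆U , there y∉G∪⁅x⁆) =
    p⊆q∧x∉p⇒p⊆q-x (⊆-trans G⊆G∪⁅x⁆ G∪⁅x⁆⊆U) x∉G , Any.map (_∘ G⊆G∪⁅x⁆) y∉G∪⁅x⁆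

  lk⇐ : ∀ {G} → Avoiding (U - x) ys G → lk (Avoiding U (x ∷ ys)) x G
  lk⇐ {G} (G⊆U-x , y∉G) =
    p⊆q-x⇒x∉p G⊆U-x , p⊆q∧x∈q⇒p∪⁅x⁆⊆q (p⊆q-x⇒p⊆q G⊆U-x) x∈U ,
    there (Any.map y∉G∪⁅x⁆ (All×Any⇒Any× x∉ys y∉G))
    where
    y∉G∪⁅x⁆ : ∀ {y} → x ≢ y × y ∉ G → y ∉ G ∪ ⁅ x ⁆
    y∉G∪⁅x⁆ {y} (x≢y , y∉G) y∈G∪⁅x⁆ =
      [ y∉G , x≢y ∘ sym ∘ x∈⁅y⁆⇒x≡y x ]′ (x∈p∪q⁻ G ⁅ x ⁆ y∈G∪⁅x⁆)

Avoiding-facet : All (_∈ U) ys → IsFacet (Avoiding U (x ∷ ys)) (U - x)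
Avoiding-facet {U = U} {ys = ys} {x = x} ys⊆U = (p─q⊆p U ⁅ x ⁆ , here x∉p-x) , maximal
  where
  maximal : ∀ G → Avoiding U (x ∷ ys) G → U - x ⊆ G → G ≡ U - x
  maximal G (G⊆U , y∉G) U-x⊆G = ⊆-antisym (p⊆q∧x∉p⇒p⊆q-x G⊆U (x∉G y∉G)) U-x⊆G
    where
    x∉G : Any (_∉ G) (x ∷ ys) → x ∉ G
    x∉G (here x∉G)  = x∉G
    x∉G (there y∉G) x∈G =
      let y , y∈U , y∉G = Any.satisfied (All×Any⇒Any× ys⊆U y∉G)
      in y∉G (U-x⊆G (x∈p∧x≢y⇒x∈p-y y∈U λ { refl → y∉G x∈G }))

All∈p∧All≢x⇒All∈p-x : All (_∈ U) ys → All (x ≢_) ys → All (_∈ U - x) ys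
All∈p∧All≢x⇒All∈p-x ys⊆U x≢ys =
  All.zipWith (λ (z∈U , x≢z) → x∈p∧x≢y⇒x∈p-y z∈U (x≢z ∘ sym)) (ys⊆U , x≢ys)

Avoiding-shedding : {y : Fin m} → x ∈ U → All (_∈ U) (y ∷ ys) → All (x ≢_) (y ∷ ys) →
  VertexDecomposable (Avoiding (U - x) (y ∷ ys)) → VertexDecomposable (Avoiding U (x ∷ y ∷ ys))
Avoiding-shedding {x = x} x∈U ys⊆U x≢ys lkVD =
  shedding x (Avoiding-vertex x∈U (All.head x≢ys))
    (simplex-vertexDecomposable del-Avoiding)
    (VertexDecomposable-resp-≋ (≋-sym (lk-Avoiding x∈U x≢ys)) lkVD)
    (λ F F-facet → subst (IsFacet _) (sym (facet-of-simplex del-Avoiding F-facet))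
                     (Avoiding-facet ys⊆U))

Avoiding-vertexDecomposable-∷ : {y : Fin m} → x ∈ U → All (_∈ U) (y ∷ ys) →
  VertexDecomposable (Avoiding U (y ∷ ys)) →
  (All (_∈ U - x) (y ∷ ys) → VertexDecomposable (Avoiding (U - x) (y ∷ ys))) →
  VertexDecomposable (Avoiding U (x ∷ y ∷ ys))
Avoiding-vertexDecomposable-∷ {x = x} {ys = ys} {y = y} x∈U ys⊆U tailVD lkVD
  with any? (x ≟_) (y ∷ ys)
... | yes x∈ys = VertexDecomposable-resp-≋ (≋-sym (Avoiding-dedup x∈ys)) tailVD
... | no  x∉ys = Avoiding-shedding x∈U ys⊆U x≢ys (lkVD (All∈p∧All≢x⇒All∈p-x ys⊆U x≢ys))
  where
  x≢ys : All (x ≢_) (y ∷ ys)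
  x≢ys = Allₚ.¬Any⇒All¬ _ x∉ys

Avoiding-vertexDecomposable : ∀ (U : Subset m) ys → All (_∈ U) ys →
  VertexDecomposable (Avoiding U ys)
Avoiding-vertexDecomposable U []           _ = simplex (inj₁ Avoiding-void)
Avoiding-vertexDecomposable U (x ∷ [])     _ = simplex-vertexDecomposable Avoiding-single
Avoiding-vertexDecomposable U (x ∷ y ∷ ys) (x∈U ∷ ys⊆U) =
  Avoiding-vertexDecomposable-∷ x∈U ys⊆U
    (Avoiding-vertexDecomposable U (y ∷ ys) ys⊆U)
    (Avoiding-vertexDecomposable (U - x) (y ∷ ys))

Generated : (Fin k → Subset m) → Cx m
Generated F G = ∃[ i ] G ⊆ F i

Generated-simplex : {F : Fin k → Subset m} (j : Fin k) → (∀ i → F i ⊆ F j) →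
  Generated F ≋ (_⊆ F j)
Generated-simplex j Fᵢ⊆Fⱼ = (λ (i , G⊆Fᵢ) → ⊆-trans G⊆Fᵢ (Fᵢ⊆Fⱼ i)) , (j ,_)

Generated-Avoiding : {F : Fin k → Subset m} {y : Fin k → Fin m} →
  (∀ i → F i ≡ U - y i) → Generated F ≋ Avoiding U (tabulate y)
Generated-Avoiding Fᵢ≡U-yᵢ =
  (λ {G} (i , G⊆Fᵢ) → let G⊆U-yᵢ = subst (G ⊆_) (Fᵢ≡U-yᵢ i) G⊆Fᵢ in
     p⊆q-x⇒p⊆q G⊆U-yᵢ , Anyₚ.tabulate⁺ i (p⊆q-x⇒x∉p G⊆U-yᵢ)) ,
  (λ {G} (G⊆U , y∉G) → let i , yᵢ∉G = Anyₚ.tabulate⁻ y∉G in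
     i , subst (G ⊆_) (sym (Fᵢ≡U-yᵢ i)) (p⊆q∧x∉p⇒p⊆q-x G⊆U yᵢ∉G))

Generated-facets⊆vertices : {F : Fin k → Subset m} → Δ ≋ Generated F →
  (∀ v → Δ ⁅ v ⁆ → v ∈ V) → ∀ i → F i ⊆ V
Generated-facets⊆vertices Δ≋⟨F⟩ vertices∈V i {v} v∈Fᵢ =
  vertices∈V v (proj₂ Δ≋⟨F⟩ (i , ⁅x⁆⊆p v∈Fᵢ))

Generated-vertexDecomposable : {r : ℕ} {F : Fin (suc k) → Subset m} →
  (∀ i → ∣ F i ∣ ≡ r) → (∀ i → F i ⊆ V) → ∣ V ∣ ≤ suc r → VertexDecomposable (Generated F)
Generated-vertexDecomposable {V = V} {F = F} ∣Fᵢ∣≡r Fᵢ⊆V ∣V∣≤1+r with m≤n⇒m<n∨m≡n ∣V∣≤1+r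
... | inj₁ ∣V∣<1+r =
  simplex-vertexDecomposable (Generated-simplex zero (λ i → ⊆-trans (Fᵢ⊆V i) V⊆F₀))
  where
  V⊆F₀ : V ⊆ F zero
  V⊆F₀ = p⊆q∧∣q∣≤∣p∣⇒q⊆p (Fᵢ⊆V zero) (subst (∣ V ∣ ≤_) (sym (∣Fᵢ∣≡r zero)) (≤-pred ∣V∣<1+r))
... | inj₂ ∣V∣≡1+r =
  VertexDecomposable-resp-≋ (≋-sym (Generated-Avoiding (proj₂ ∘ proj₂ ∘ omitted)))
    (Avoiding-vertexDecomposable V _ (Allₚ.tabulate⁺ (proj₁ ∘ proj₂ ∘ omitted)))
  where
  omitted : ∀ i → ∃[ y ] (y ∈ V × F i ≡ V - y)
  omitted i = p⊆q∧∣q∣≡1+∣p∣⇒p≡q-x (Fᵢ⊆V i) (trans ∣V∣≡1+r (cong suc (sym (∣Fᵢ∣≡r i))))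

lemma4p3 : {n : ℕ} (Δ : Subset n → Set) (r : ℕ) →
    PureShellable r Δ → AtMostVertices (suc r) Δ → VertexDecomposable Δ
lemma4p3 Δ r (_ , F , _ , ∣Fᵢ∣≡r , Δ⇔⟨F⟩ , _) (V , ∣V∣≤1+r , vertices∈V) =
  VertexDecomposable-resp-≋ (≋-sym Δ≋⟨F⟩)
    (Generated-vertexDecomposable ∣Fᵢ∣≡r (Generated-facets⊆vertices Δ≋⟨F⟩ vertices∈V) ∣V∣≤1+r)
  where
  Δ≋⟨F⟩ : Δ ≋ Generated F
  Δ≋⟨F⟩ = ⇔⇒≋ Δ⇔⟨F⟩
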